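{- Let $r_1,r_2,r_3$ be three distinct ridges of $C^d$ such that $r_1\cup r_2\cup r_3$ does not contain any pair of antipodal peaks, and suppose each $r_i$ fixes the $j$-th coordinate. Then the $j$-th coordinate values of $r_1,r_2,r_3$ agree; that is, all three ridges lie in the same facet of $C^d$.
   Context: $C^d=[0,1]^d$. A nonempty $k$-face of $C^d$ is given by a word in $\{0,1,X\}^d$ with exactly $k$ letters $X$; the non-$X$ positions are the fixed coordinate positions with their values. The empty set is the face of dimension $-1$ and is antipodal to itself. Two $k$-faces are antipodal iff they have exactly the same fixed positions and differ in every fixed position. A ridge is a $(d-2)$-face, a peak a $(d-3)$-face, a facet a $(d-1)$-face. A set contains a pair of antipodal peaks if two antipodal peaks are both contained in it.
   Formalization: The points of $C^d=[0,1]^d$ used to test whether $r_1\cup r_2\cup r_3$ contains a pair of antipodal peaks are taken with rational coordinates. -}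

module Defs where

open import Data.Nat using (ℕ; zero; suc; _+_)
open import Data.Integer using (ℤ; +_; -[1+_]; _-_)
open import Data.Rational using (ℚ; 0ℚ; 1ℚ; _≤_)
open import Data.Fin using (Fin)
open import Data.Vec using (Vec; []; _∷_; lookup)
open import Data.Product using (_×_; Σ)
open import Data.Sum using (_⊎_)
open import Data.Empty using (⊥)
open import Data.Unit using (⊤)
open import Relation.Binary.PropositionalEquality using (_≡_; _≢_)

-- Letters of a face word: fixed to 0, fixed to 1, or free (X).
data Letter : Set where
  𝟎 𝟏 X : Letter

data Face (d : ℕ) : Set where
  ∅    : Face d
  word : Vec Letter d → Face d

countX : ∀ {d} → Vec Letter d → ℕ
countX []       = zero
countX (X ∷ w)  = suc (countX w)
countX (𝟎 ∷ w)  = countX w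
countX (𝟏 ∷ w)  = countX w

dim : ∀ {d} → Face d → ℤ
dim ∅        = -[1+ 0 ]
dim (word w) = + countX w

Ridge : (d : ℕ) → Face d → Set
Ridge d f = dim f ≡ (+ d) - (+ 2)

Peak : (d : ℕ) → Face d → Set
Peak d f = dim f ≡ (+ d) - (+ 3)

data AntiLetter : Letter → Letter → Set where
  XX : AntiLetter X X
  a01 : AntiLetter 𝟎 𝟏
  a10 : AntiLetter 𝟏 𝟎

AntiWord : ∀ {d} → Vec Letter d → Vec Letter d → Set
AntiWord []      []      = ⊤
AntiWord (a ∷ v) (b ∷ w) = AntiLetter a b × AntiWord v w

Antipodal : ∀ {d} → Face d → Face d → Set
Antipodal ∅        ∅        = ⊤
Antipodal ∅        (word _) = ⊥
Antipodal (word _) ∅        = ⊥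
Antipodal (word v) (word w) = AntiWord v w

Point : ℕ → Set
Point d = Vec ℚ d

InCube : ∀ {d} → Point d → Set
InCube []      = ⊤
InCube (q ∷ x) = (0ℚ ≤ q × q ≤ 1ℚ) × InCube x

LetterHolds : Letter → ℚ → Set
LetterHolds 𝟎 q = q ≡ 0ℚ
LetterHolds 𝟏 q = q ≡ 1ℚ
LetterHolds X q = ⊤

WordHolds : ∀ {d} → Vec Letter d → Point d → Set
WordHolds []      []      = ⊤
WordHolds (a ∷ w) (q ∷ x) = LetterHolds a q × WordHolds w x

_∈F_ : ∀ {d} → Point d → Face d → Set
x ∈F ∅      = ⊥
x ∈F word w = InCube x × WordHolds w x

_⊆S_ : ∀ {d} → Face d → (Point d → Set) → Set
f ⊆S S = ∀ x → x ∈F f → S x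

Union3 : ∀ {d} → Face d → Face d → Face d → Point d → Set
Union3 r₁ r₂ r₃ x = x ∈F r₁ ⊎ x ∈F r₂ ⊎ x ∈F r₃

ContainsAntipodalPeaks : (d : ℕ) → (Point d → Set) → Set
ContainsAntipodalPeaks d S =
  Σ (Face d) λ p → Σ (Face d) λ q →
    Peak d p × Peak d q × Antipodal p q × p ⊆S S × q ⊆S S

HasAt : ∀ {d} → Face d → Fin d → Letter → Set
HasAt ∅        j a = ⊥
HasAt (word w) j a = lookup w j ≡ a

Fixes : ∀ {d} → Face d → Fin d → Set
Fixes ∅        j = ⊥
Fixes (word w) j = lookup w j ≢ X

-- A ridge fixes exactly two coordinates. Let u, w be ridges taking opposite
-- values at the common fixed coordinate j. If u and w share no fixed
-- coordinate with equal values, fixing the coordinates they leave free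
-- suitably gives a peak below u whose antipode lies below w (there are
-- enough common free coordinates, since together u and w fix at most three).
-- Otherwise they fix the same two coordinates and agree on the second one,
-- so u is w with coordinate j changed. Among three ridges fixing j, if the
-- values at j are not all equal, two of them agree there and oppose the
-- third; by the above, both equal the third with coordinate j changed, so
-- they coincide.
module Submission where

open import Defs
open import Data.Nat using (ℕ; zero; suc; _+_; _∸_; _≤_; z≤n; s≤s)
open import Data.Nat.Properties
  using (suc-injective; +-suc; +-comm; +-cancelˡ-≡; n≤1+n; ≤-refl; ≤-trans; 1+n≰n; m∸[m∸n]≡n; 0∸n≡0)
open import Data.Integer using (+_)
import Data.Integer.Properties as ℤ
open import Data.Fin using (Fin; zero; suc)
open import Data.Vec using (Vec; []; _∷_; lookup; map; _[_]≔_)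
open import Data.Vec.Relation.Binary.Pointwise.Inductive using (Pointwise; []; _∷_)
open import Data.Product using (Σ; _×_; _,_)
open import Data.Sum using (_⊎_; inj₁; inj₂; map₂)
open import Data.Empty using (⊥-elim)
open import Data.Unit using (tt)
open import Data.Bool using (Bool; true; false; if_then_else_)
open import Relation.Nullary using (¬_)
open import Function using (case_of_)
open import Relation.Binary.PropositionalEquality
  using (_≡_; _≢_; refl; sym; trans; cong; subst; module ≡-Reasoning)

private
  variable
    d n : ℕ

data Opposed : Letter → Letter → Set where
  𝟎𝟏 : Opposed 𝟎 𝟏
  𝟏𝟎 : Opposed 𝟏 𝟎

flip : Letter → Letter
flip 𝟎 = 𝟏
flip 𝟏 = 𝟎
flip X = X

opposite : Vec Letter d → Vec Letter d
opposite = map flip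

antiWord-opposite : (v : Vec Letter d) → AntiWord v (opposite v)
antiWord-opposite []      = tt
antiWord-opposite (𝟎 ∷ v) = a01 , antiWord-opposite v
antiWord-opposite (𝟏 ∷ v) = a10 , antiWord-opposite v
antiWord-opposite (X ∷ v) = XX , antiWord-opposite v

countX-opposite : (v : Vec Letter d) → countX (opposite v) ≡ countX v
countX-opposite []      = refl
countX-opposite (𝟎 ∷ v) = countX-opposite v
countX-opposite (𝟏 ∷ v) = countX-opposite v
countX-opposite (X ∷ v) = cong suc (countX-opposite v)

data _≼_ : Letter → Letter → Set where
  ≼-X    : ∀ {a} → a ≼ X
  ≼-refl : ∀ {a} → a ≼ a

_⊑_ : Vec Letter d → Vec Letter d → Set
_⊑_ = Pointwise _≼_

wordHolds-⊑ : {p u : Vec Letter d} (x : Point d) → p ⊑ u → WordHolds p x → WordHolds u x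
wordHolds-⊑ []      []             _        = tt
wordHolds-⊑ (_ ∷ x) (≼-X ∷ p⊑u)    (_ , h)  = tt , wordHolds-⊑ x p⊑u h
wordHolds-⊑ (_ ∷ x) (≼-refl ∷ p⊑u) (hₐ , h) = hₐ , wordHolds-⊑ x p⊑u h

⊆S-⊑ : {p u : Vec Letter d} {S : Point d → Set} → p ⊑ u → word u ⊆S S → word p ⊆S S
⊆S-⊑ p⊑u u⊆S x (x∈C , h) = u⊆S x (x∈C , wordHolds-⊑ x p⊑u h)

data Overlap : Set where
  bothFree freeFixed fixedFree agree disagree : Overlap

overlapOf : Letter → Letter → Overlap
overlapOf X X = bothFree
overlapOf X _ = freeFixed
overlapOf _ X = fixedFree
overlapOf 𝟎 𝟎 = agree
overlapOf 𝟏 𝟏 = agree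
overlapOf _ _ = disagree

_==_ : Overlap → Overlap → Bool
bothFree  == bothFree  = true
freeFixed == freeFixed = true
fixedFree == fixedFree = true
agree     == agree     = true
disagree  == disagree  = true
_         == _         = false

tally : Overlap → Vec Letter d → Vec Letter d → ℕ
tally c []      []      = 0
tally c (a ∷ u) (b ∷ w) = if c == overlapOf a b then suc (tally c u w) else tally c u w

fixedCount : Vec Letter d → ℕ
fixedCount []      = 0
fixedCount (X ∷ u) = fixedCount u
fixedCount (𝟎 ∷ u) = suc (fixedCount u)
fixedCount (𝟏 ∷ u) = suc (fixedCount u)

countX+fixedCount : (u : Vec Letter d) → countX u + fixedCount u ≡ d
countX+fixedCount []      = refl
countX+fixedCount (X ∷ u) = cong suc (countX+fixedCount u)
countX+fixedCount (𝟎 ∷ u) = trans (+-suc (countX u) _) (cong suc (countX+fixedCount u))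
countX+fixedCount (𝟏 ∷ u) = trans (+-suc (countX u) _) (cong suc (countX+fixedCount u))

countX-tally : (u w : Vec Letter d) → countX u ≡ tally freeFixed u w + tally bothFree u w
countX-tally []      []      = refl
countX-tally (X ∷ u) (X ∷ w) = trans (cong suc (countX-tally u w)) (sym (+-suc _ _))
countX-tally (X ∷ u) (𝟎 ∷ w) = cong suc (countX-tally u w)
countX-tally (X ∷ u) (𝟏 ∷ w) = cong suc (countX-tally u w)
countX-tally (𝟎 ∷ u) (X ∷ w) = countX-tally u w
countX-tally (𝟎 ∷ u) (𝟎 ∷ w) = countX-tally u w
countX-tally (𝟎 ∷ u) (𝟏 ∷ w) = countX-tally u w
countX-tally (𝟏 ∷ u) (X ∷ w) = countX-tally u w
countX-tally (𝟏 ∷ u) (𝟎 ∷ w) = countX-tally u w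
countX-tally (𝟏 ∷ u) (𝟏 ∷ w) = countX-tally u w

private
  suc-+ʳ : ∀ {m s k} → m ≡ s + k → suc m ≡ s + suc k
  suc-+ʳ {s = s} {k} eq = trans (cong suc eq) (sym (+-suc s k))

  suc-+ᵐ : ∀ a {b k m} → m ≡ a + b + k → suc m ≡ a + suc b + k
  suc-+ᵐ a {b} {k} eq = trans (cong suc eq) (cong (_+ k) (sym (+-suc a b)))
fixedCount-tallyˡ : (u w : Vec Letter d) →
  fixedCount u ≡ tally agree u w + tally disagree u w + tally fixedFree u w
fixedCount-tallyˡ []      []      = refl
fixedCount-tallyˡ (X ∷ u) (X ∷ w) = fixedCount-tallyˡ u w
fixedCount-tallyˡ (X ∷ u) (𝟎 ∷ w) = fixedCount-tallyˡ u w
fixedCount-tallyˡ (X ∷ u) (𝟏 ∷ w) = fixedCount-tallyˡ u w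
fixedCount-tallyˡ (𝟎 ∷ u) (X ∷ w) = suc-+ʳ (fixedCount-tallyˡ u w)
fixedCount-tallyˡ (𝟏 ∷ u) (X ∷ w) = suc-+ʳ (fixedCount-tallyˡ u w)
fixedCount-tallyˡ (𝟎 ∷ u) (𝟎 ∷ w) = cong suc (fixedCount-tallyˡ u w)
fixedCount-tallyˡ (𝟏 ∷ u) (𝟏 ∷ w) = cong suc (fixedCount-tallyˡ u w)
fixedCount-tallyˡ (𝟎 ∷ u) (𝟏 ∷ w) = suc-+ᵐ (tally agree u w) (fixedCount-tallyˡ u w)
fixedCount-tallyˡ (𝟏 ∷ u) (𝟎 ∷ w) = suc-+ᵐ (tally agree u w) (fixedCount-tallyˡ u w)

fixedCount-tallyʳ : (u w : Vec Letter d) →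
  fixedCount w ≡ tally agree u w + tally disagree u w + tally freeFixed u w
fixedCount-tallyʳ []      []      = refl
fixedCount-tallyʳ (X ∷ u) (X ∷ w) = fixedCount-tallyʳ u w
fixedCount-tallyʳ (𝟎 ∷ u) (X ∷ w) = fixedCount-tallyʳ u w
fixedCount-tallyʳ (𝟏 ∷ u) (X ∷ w) = fixedCount-tallyʳ u w
fixedCount-tallyʳ (X ∷ u) (𝟎 ∷ w) = suc-+ʳ (fixedCount-tallyʳ u w)
fixedCount-tallyʳ (X ∷ u) (𝟏 ∷ w) = suc-+ʳ (fixedCount-tallyʳ u w)
fixedCount-tallyʳ (𝟎 ∷ u) (𝟎 ∷ w) = cong suc (fixedCount-tallyʳ u w)
fixedCount-tallyʳ (𝟏 ∷ u) (𝟏 ∷ w) = cong suc (fixedCount-tallyʳ u w)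
fixedCount-tallyʳ (𝟎 ∷ u) (𝟏 ∷ w) = suc-+ᵐ (tally agree u w) (fixedCount-tallyʳ u w)
fixedCount-tallyʳ (𝟏 ∷ u) (𝟎 ∷ w) = suc-+ᵐ (tally agree u w) (fixedCount-tallyʳ u w)

fixedCount-ridge : (u : Vec Letter (3 + n)) → countX u ≡ suc n → fixedCount u ≡ 2
fixedCount-ridge {n} u cu = +-cancelˡ-≡ (suc n) _ _
  (trans (trans (cong (_+ fixedCount u) (sym cu)) (countX+fixedCount u)) (cong suc (+-comm 2 n)))

-- xx, xf, fx, ag, dis are the tallies of bothFree, freeFixed, fixedFree, agree, disagree
-- for two ridges of C^(3+n).
ridge-pair-arithmetic : ∀ {n xx xf fx ag dis} →
  xf + xx ≡ suc n → ag + dis + fx ≡ 2 → ag + dis + xf ≡ 2 → 1 ≤ dis →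
  (ag ≡ 0 × n ≤ xx) ⊎ (xf ≡ 0 × fx ≡ 0 × dis ≡ 1)
ridge-pair-arithmetic     {ag = 0} {1}                 refl _    refl _ = inj₁ (refl , ≤-refl)
ridge-pair-arithmetic {n} {ag = 0} {2}                 refl _    refl _ = inj₁ (refl , n≤1+n n)
ridge-pair-arithmetic     {ag = 0} {suc (suc (suc _))} _    _    ()   _
ridge-pair-arithmetic     {ag = 1} {1}                 _    refl refl _ = inj₂ (refl , refl , refl)
ridge-pair-arithmetic     {ag = 1} {suc (suc _)}       _    ()   _    _
ridge-pair-arithmetic     {ag = 2} {suc _}             _    ()   _    _
ridge-pair-arithmetic     {ag = suc (suc (suc _))} {suc _} _ ()  _    _

tally-step : ∀ c a b (u w : Vec Letter d) → tally c u w ≤ tally c (a ∷ u) (b ∷ w)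
tally-step c a b u w with c == overlapOf a b
... | true  = n≤1+n _
... | false = ≤-refl

opposed⇒disagree : (u w : Vec Letter d) (j : Fin d) →
  Opposed (lookup u j) (lookup w j) → 1 ≤ tally disagree u w
opposed⇒disagree (𝟎 ∷ _) (𝟏 ∷ _) zero    𝟎𝟏 = s≤s z≤n
opposed⇒disagree (𝟏 ∷ _) (𝟎 ∷ _) zero    𝟏𝟎 = s≤s z≤n
opposed⇒disagree (a ∷ u) (b ∷ w) (suc j) op =
  ≤-trans (opposed⇒disagree u w j op) (tally-step disagree a b u w)

no-mismatch⇒≡ : (u w : Vec Letter d) →
  tally freeFixed u w ≡ 0 → tally fixedFree u w ≡ 0 → tally disagree u w ≡ 0 → u ≡ w
no-mismatch⇒≡ []      []      _  _  _  = refl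
no-mismatch⇒≡ (X ∷ u) (X ∷ w) xf fx ds = cong (X ∷_) (no-mismatch⇒≡ u w xf fx ds)
no-mismatch⇒≡ (𝟎 ∷ u) (𝟎 ∷ w) xf fx ds = cong (𝟎 ∷_) (no-mismatch⇒≡ u w xf fx ds)
no-mismatch⇒≡ (𝟏 ∷ u) (𝟏 ∷ w) xf fx ds = cong (𝟏 ∷_) (no-mismatch⇒≡ u w xf fx ds)
no-mismatch⇒≡ (X ∷ u) (𝟎 ∷ w) () _  _
no-mismatch⇒≡ (X ∷ u) (𝟏 ∷ w) () _  _
no-mismatch⇒≡ (𝟎 ∷ u) (X ∷ w) _  () _
no-mismatch⇒≡ (𝟏 ∷ u) (X ∷ w) _  () _
no-mismatch⇒≡ (𝟎 ∷ u) (𝟏 ∷ w) _  _  ()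
no-mismatch⇒≡ (𝟏 ∷ u) (𝟎 ∷ w) _  _  ()

single-mismatch⇒≡[]≔ : (u w : Vec Letter d) (j : Fin d) →
  tally freeFixed u w ≡ 0 → tally fixedFree u w ≡ 0 → tally disagree u w ≡ 1 →
  Opposed (lookup u j) (lookup w j) → u ≡ w [ j ]≔ lookup u j
single-mismatch⇒≡[]≔ (𝟎 ∷ u) (𝟏 ∷ w) zero xf fx ds 𝟎𝟏 =
  cong (𝟎 ∷_) (no-mismatch⇒≡ u w xf fx (suc-injective ds))
single-mismatch⇒≡[]≔ (𝟏 ∷ u) (𝟎 ∷ w) zero xf fx ds 𝟏𝟎 =
  cong (𝟏 ∷_) (no-mismatch⇒≡ u w xf fx (suc-injective ds))
single-mismatch⇒≡[]≔ (X ∷ u) (X ∷ w) (suc j) xf fx ds op =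
  cong (X ∷_) (single-mismatch⇒≡[]≔ u w j xf fx ds op)
single-mismatch⇒≡[]≔ (𝟎 ∷ u) (𝟎 ∷ w) (suc j) xf fx ds op =
  cong (𝟎 ∷_) (single-mismatch⇒≡[]≔ u w j xf fx ds op)
single-mismatch⇒≡[]≔ (𝟏 ∷ u) (𝟏 ∷ w) (suc j) xf fx ds op =
  cong (𝟏 ∷_) (single-mismatch⇒≡[]≔ u w j xf fx ds op)
single-mismatch⇒≡[]≔ (X ∷ u) (𝟎 ∷ w) (suc j) () _ _ _
single-mismatch⇒≡[]≔ (X ∷ u) (𝟏 ∷ w) (suc j) () _ _ _
single-mismatch⇒≡[]≔ (𝟎 ∷ u) (X ∷ w) (suc j) _ () _ _
single-mismatch⇒≡[]≔ (𝟏 ∷ u) (X ∷ w) (suc j) _ () _ _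
single-mismatch⇒≡[]≔ (𝟎 ∷ u) (𝟏 ∷ w) (suc j) _ _ ds op =
  ⊥-elim (1+n≰n (subst (1 ≤_) (suc-injective ds) (opposed⇒disagree u w j op)))
single-mismatch⇒≡[]≔ (𝟏 ∷ u) (𝟎 ∷ w) (suc j) _ _ ds op =
  ⊥-elim (1+n≰n (subst (1 ≤_) (suc-injective ds) (opposed⇒disagree u w j op)))

-- A subface of u whose antipode lies in w (when they agree at no fixed coordinate),
-- obtained by fixing m of their common free coordinates.
antipodalSubface : Vec Letter d → Vec Letter d → ℕ → Vec Letter d
antipodalSubface []      []      m       = []
antipodalSubface (X ∷ u) (X ∷ w) zero    = X ∷ antipodalSubface u w zero
antipodalSubface (X ∷ u) (X ∷ w) (suc m) = 𝟎 ∷ antipodalSubface u w m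
antipodalSubface (X ∷ u) (b ∷ w) m       = flip b ∷ antipodalSubface u w m
antipodalSubface (a ∷ u) (_ ∷ w) m       = a ∷ antipodalSubface u w m

antipodalSubface-⊑ : (u w : Vec Letter d) (m : ℕ) → antipodalSubface u w m ⊑ u
antipodalSubface-⊑ []      []      m       = []
antipodalSubface-⊑ (X ∷ u) (X ∷ w) zero    = ≼-X ∷ antipodalSubface-⊑ u w zero
antipodalSubface-⊑ (X ∷ u) (X ∷ w) (suc m) = ≼-X ∷ antipodalSubface-⊑ u w m
antipodalSubface-⊑ (X ∷ u) (𝟎 ∷ w) m       = ≼-X ∷ antipodalSubface-⊑ u w m
antipodalSubface-⊑ (X ∷ u) (𝟏 ∷ w) m       = ≼-X ∷ antipodalSubface-⊑ u w m
antipodalSubface-⊑ (𝟎 ∷ u) (_ ∷ w) m       = ≼-refl ∷ antipodalSubface-⊑ u w m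
antipodalSubface-⊑ (𝟏 ∷ u) (_ ∷ w) m       = ≼-refl ∷ antipodalSubface-⊑ u w m

opposite-antipodalSubface-⊑ : (u w : Vec Letter d) (m : ℕ) →
  tally agree u w ≡ 0 → opposite (antipodalSubface u w m) ⊑ w
opposite-antipodalSubface-⊑ []      []      m       _  = []
opposite-antipodalSubface-⊑ (X ∷ u) (X ∷ w) zero    ag = ≼-X ∷ opposite-antipodalSubface-⊑ u w zero ag
opposite-antipodalSubface-⊑ (X ∷ u) (X ∷ w) (suc m) ag = ≼-X ∷ opposite-antipodalSubface-⊑ u w m ag
opposite-antipodalSubface-⊑ (X ∷ u) (𝟎 ∷ w) m       ag = ≼-refl ∷ opposite-antipodalSubface-⊑ u w m ag
opposite-antipodalSubface-⊑ (X ∷ u) (𝟏 ∷ w) m       ag = ≼-refl ∷ opposite-antipodalSubface-⊑ u w m ag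
opposite-antipodalSubface-⊑ (𝟎 ∷ u) (X ∷ w) m       ag = ≼-X ∷ opposite-antipodalSubface-⊑ u w m ag
opposite-antipodalSubface-⊑ (𝟏 ∷ u) (X ∷ w) m       ag = ≼-X ∷ opposite-antipodalSubface-⊑ u w m ag
opposite-antipodalSubface-⊑ (𝟎 ∷ u) (𝟏 ∷ w) m       ag = ≼-refl ∷ opposite-antipodalSubface-⊑ u w m ag
opposite-antipodalSubface-⊑ (𝟏 ∷ u) (𝟎 ∷ w) m       ag = ≼-refl ∷ opposite-antipodalSubface-⊑ u w m ag
opposite-antipodalSubface-⊑ (𝟎 ∷ u) (𝟎 ∷ w) m       ()
opposite-antipodalSubface-⊑ (𝟏 ∷ u) (𝟏 ∷ w) m       ()

countX-antipodalSubface : (u w : Vec Letter d) (m : ℕ) →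
  countX (antipodalSubface u w m) ≡ tally bothFree u w ∸ m
countX-antipodalSubface []      []      m       = sym (0∸n≡0 m)
countX-antipodalSubface (X ∷ u) (X ∷ w) zero    = cong suc (countX-antipodalSubface u w zero)
countX-antipodalSubface (X ∷ u) (X ∷ w) (suc m) = countX-antipodalSubface u w m
countX-antipodalSubface (X ∷ u) (𝟎 ∷ w) m       = countX-antipodalSubface u w m
countX-antipodalSubface (X ∷ u) (𝟏 ∷ w) m       = countX-antipodalSubface u w m
countX-antipodalSubface (𝟎 ∷ u) (X ∷ w) m       = countX-antipodalSubface u w m
countX-antipodalSubface (𝟎 ∷ u) (𝟎 ∷ w) m       = countX-antipodalSubface u w m
countX-antipodalSubface (𝟎 ∷ u) (𝟏 ∷ w) m       = countX-antipodalSubface u w m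
countX-antipodalSubface (𝟏 ∷ u) (X ∷ w) m       = countX-antipodalSubface u w m
countX-antipodalSubface (𝟏 ∷ u) (𝟎 ∷ w) m       = countX-antipodalSubface u w m
countX-antipodalSubface (𝟏 ∷ u) (𝟏 ∷ w) m       = countX-antipodalSubface u w m

separated⇒antipodalPeaks : (u w : Vec Letter (3 + n)) {S : Point (3 + n) → Set} →
  word u ⊆S S → word w ⊆S S → tally agree u w ≡ 0 → n ≤ tally bothFree u w →
  ContainsAntipodalPeaks (3 + n) S
separated⇒antipodalPeaks {n} u w u⊆S w⊆S ag≡0 n≤free =
  word p , word (opposite p) , cong +_ countX-p , cong +_ (trans (countX-opposite p) countX-p) ,
  antiWord-opposite p ,
  ⊆S-⊑ (antipodalSubface-⊑ u w m) u⊆S , ⊆S-⊑ (opposite-antipodalSubface-⊑ u w m ag≡0) w⊆S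
  where
  m : ℕ
  m = tally bothFree u w ∸ n
  p : Vec Letter (3 + n)
  p = antipodalSubface u w m
  countX-p : countX p ≡ n
  countX-p = trans (countX-antipodalSubface u w m) (m∸[m∸n]≡n n≤free)

opposed-ridges-dichotomy : (u w : Vec Letter (3 + n)) (j : Fin (3 + n)) →
  countX u ≡ suc n → countX w ≡ suc n → Opposed (lookup u j) (lookup w j) →
  (tally agree u w ≡ 0 × n ≤ tally bothFree u w) ⊎ u ≡ w [ j ]≔ lookup u j
opposed-ridges-dichotomy u w j countX-u countX-w op =
  map₂ (λ (xf , fx , ds) → single-mismatch⇒≡[]≔ u w j xf fx ds op)
    (ridge-pair-arithmetic
      (trans (sym (countX-tally u w)) countX-u)
      (trans (sym (fixedCount-tallyˡ u w)) (fixedCount-ridge u countX-u))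
      (trans (sym (fixedCount-tallyʳ u w)) (fixedCount-ridge w countX-w))
      (opposed⇒disagree u w j op))

opposed-ridges-differ-only-at : {S : Point (3 + n) → Set} (u w : Vec Letter (3 + n)) (j : Fin (3 + n)) →
  Ridge (3 + n) (word u) → Ridge (3 + n) (word w) → word u ⊆S S → word w ⊆S S →
  ¬ ContainsAntipodalPeaks (3 + n) S → Opposed (lookup u j) (lookup w j) →
  u ≡ w [ j ]≔ lookup u j
opposed-ridges-differ-only-at u w j ridge-u ridge-w u⊆S w⊆S noPeaks op
  with opposed-ridges-dichotomy u w j (ℤ.+-injective ridge-u) (ℤ.+-injective ridge-w) op
... | inj₁ (ag≡0 , n≤free) = ⊥-elim (noPeaks (separated⇒antipodalPeaks u w u⊆S w⊆S ag≡0 n≤free))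
... | inj₂ u≡w[j]≔ = u≡w[j]≔

ridges-agreeing-against-opposed : {S : Point (3 + n) → Set} (u v w : Vec Letter (3 + n)) (j : Fin (3 + n)) →
  Ridge (3 + n) (word u) → Ridge (3 + n) (word v) → Ridge (3 + n) (word w) →
  word u ⊆S S → word v ⊆S S → word w ⊆S S → ¬ ContainsAntipodalPeaks (3 + n) S →
  lookup u j ≡ lookup v j → Opposed (lookup u j) (lookup w j) → u ≡ v
ridges-agreeing-against-opposed u v w j ridge-u ridge-v ridge-w u⊆S v⊆S w⊆S noPeaks uⱼ≡vⱼ op =
  begin
    u                      ≡⟨ opposed-ridges-differ-only-at u w j ridge-u ridge-w u⊆S w⊆S noPeaks op ⟩
    w [ j ]≔ lookup u j    ≡⟨ cong (w [ j ]≔_) uⱼ≡vⱼ ⟩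
    w [ j ]≔ lookup v j    ≡⟨ opposed-ridges-differ-only-at v w j ridge-v ridge-w v⊆S w⊆S noPeaks
                                (subst (λ a → Opposed a (lookup w j)) uⱼ≡vⱼ op) ⟨
    v                      ∎
  where open ≡-Reasoning

fixed-letters : ∀ {a b c} → a ≢ X → b ≢ X → c ≢ X →
  (a ≡ b × a ≡ c) ⊎ (a ≡ b × Opposed a c) ⊎ (a ≡ c × Opposed a b) ⊎ (b ≡ c × Opposed b a)
fixed-letters {X}         a≢X _   _   = ⊥-elim (a≢X refl)
fixed-letters {_} {X}     _   b≢X _   = ⊥-elim (b≢X refl)
fixed-letters {_} {_} {X} _   _   c≢X = ⊥-elim (c≢X refl)
fixed-letters {𝟎} {𝟎} {𝟎} _   _   _   = inj₁ (refl , refl)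
fixed-letters {𝟏} {𝟏} {𝟏} _   _   _   = inj₁ (refl , refl)
fixed-letters {𝟎} {𝟎} {𝟏} _   _   _   = inj₂ (inj₁ (refl , 𝟎𝟏))
fixed-letters {𝟏} {𝟏} {𝟎} _   _   _   = inj₂ (inj₁ (refl , 𝟏𝟎))
fixed-letters {𝟎} {𝟏} {𝟎} _   _   _   = inj₂ (inj₂ (inj₁ (refl , 𝟎𝟏)))
fixed-letters {𝟏} {𝟎} {𝟏} _   _   _   = inj₂ (inj₂ (inj₁ (refl , 𝟏𝟎)))
fixed-letters {𝟏} {𝟎} {𝟎} _   _   _   = inj₂ (inj₂ (inj₂ (refl , 𝟎𝟏)))
fixed-letters {𝟎} {𝟏} {𝟏} _   _   _   = inj₂ (inj₂ (inj₂ (refl , 𝟏𝟎)))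

lemma6 : (d : ℕ) (r₁ r₂ r₃ : Face d) (j : Fin d)
    → Ridge d r₁ → Ridge d r₂ → Ridge d r₃
    → r₁ ≢ r₂ → r₁ ≢ r₃ → r₂ ≢ r₃
    → ¬ ContainsAntipodalPeaks d (Union3 r₁ r₂ r₃)
    → Fixes r₁ j → Fixes r₂ j → Fixes r₃ j
    → Σ Letter λ a → HasAt r₁ j a × HasAt r₂ j a × HasAt r₃ j a
lemma6 d ∅        _        _        j _ _ _ _ _ _ _ () _  _
lemma6 d (word _) ∅        _        j _ _ _ _ _ _ _ _  () _
lemma6 d (word _) (word _) ∅        j _ _ _ _ _ _ _ _  _  ()
lemma6 1 (word _) (word _) (word _) j () _ _ _ _ _ _ _ _ _
-- In C², the empty face is a peak and is its own antipode.
lemma6 2 (word _) (word _) (word _) j _ _ _ _ _ _ noPeaks _ _ _ =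
  ⊥-elim (noPeaks (∅ , ∅ , refl , refl , tt , (λ _ ()) , (λ _ ())))
lemma6 (suc (suc (suc n))) (word u₁) (word u₂) (word u₃) j R₁ R₂ R₃ r₁≢r₂ r₁≢r₃ r₂≢r₃ noPeaks f₁ f₂ f₃ =
  case fixed-letters f₁ f₂ f₃ of λ where
    (inj₁ (e₁₂ , e₁₃)) → lookup u₁ j , refl , sym e₁₂ , sym e₁₃
    (inj₂ (inj₁ (e₁₂ , o₁₃))) →
      ⊥-elim (r₁≢r₂ (cong word (ridges-agreeing-against-opposed u₁ u₂ u₃ j R₁ R₂ R₃ ⊆₁ ⊆₂ ⊆₃ noPeaks e₁₂ o₁₃)))
    (inj₂ (inj₂ (inj₁ (e₁₃ , o₁₂)))) →
      ⊥-elim (r₁≢r₃ (cong word (ridges-agreeing-against-opposed u₁ u₃ u₂ j R₁ R₃ R₂ ⊆₁ ⊆₃ ⊆₂ noPeaks e₁₃ o₁₂)))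
    (inj₂ (inj₂ (inj₂ (e₂₃ , o₂₁)))) →
      ⊥-elim (r₂≢r₃ (cong word (ridges-agreeing-against-opposed u₂ u₃ u₁ j R₂ R₃ R₁ ⊆₂ ⊆₃ ⊆₁ noPeaks e₂₃ o₂₁)))
  where
  S : Point (3 + n) → Set
  S = Union3 (word u₁) (word u₂) (word u₃)
  ⊆₁ : word u₁ ⊆S S
  ⊆₁ _ x∈ = inj₁ x∈
  ⊆₂ : word u₂ ⊆S S
  ⊆₂ _ x∈ = inj₂ (inj₁ x∈)
  ⊆₃ : word u₃ ⊆S S
  ⊆₃ _ x∈ = inj₂ (inj₂ x∈)
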